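{- Let $\Pi$ be an $E$-linear representation of $\mathrm{B}$, let $v\neq0$ be a vector of $\Pi$ fixed by $\begin{pmatrix}1&\mathbf{Z}_p\\0&1\end{pmatrix}$, and let $k\geq0$. Then one of the $p^k$ elements \[v_\ell=\sum_{j=0}^{p^k-1}\binom{j}{\ell}\tau_k^j(v),\qquad0\leq\ell\leq p^k-1,\] is nonzero and fixed by $\tau_k$.
   Context: $p$ prime, $E$ a finite extension of $\mathbf{F}_p$, $\mathrm{B}$ the invertible upper triangular $2\times2$ matrices over $\mathbf{Q}_p$. $\tau_k=\begin{pmatrix}1&-1/p^k\\0&1\end{pmatrix}$. Binomial coefficients are defined by $(1+X)^j=\sum_i\binom{j}{i}X^i$ and viewed in $\mathbf{F}_p$. -}

module Defs where

open import Level using (Level; _⊔_) renaming (zero to 0ℓ)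
open import Data.Nat as ℕ using (ℕ; zero; suc; _^_)
open import Data.Nat.Combinatorics using (_C_)
open import Data.Integer as ℤ using (ℤ; +_; -[1+_]; _+_; _*_; _-_)
open import Data.Integer.Divisibility.Signed using (_∣_; ∣m∣n⇒∣m+n; ∣n⇒∣m*n; ∣m⇒∣m*n)
open import Data.Integer.Tactic.RingSolver using (solve-∀)
open import Data.Fin using (Fin)
open import Data.Product using (Σ; ∃; _×_; _,_)
open import Relation.Binary.PropositionalEquality using (_≡_; refl; subst; sym)
open import Relation.Nullary using (¬_)
open import Algebra.Bundles using (CommutativeRing)
open import Algebra.Module.Bundles using (Module)

-- p-adic integers ℤₚ as coherent sequences (inverse limit of ℤ/p^n):
-- seq n represents the class mod p^n, and seq (n+1) ≡ seq n mod p^n.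

record ℤₚ (p : ℕ) : Set where
  constructor mkℤₚ
  field
    seq : ℕ → ℤ
    coh : ∀ n → (+ (p ^ n)) ∣ (seq (suc n) - seq n)
open ℤₚ public

module _ {p : ℕ} where

  _≈ₚ_ : ℤₚ p → ℤₚ p → Set
  x ≈ₚ y = ∀ n → (+ (p ^ n)) ∣ (seq x n - seq y n)

  private
    add-lem : ∀ a b c d → (a + b) - (c + d) ≡ (a - c) + (b - d)
    add-lem = solve-∀
    mul-lem : ∀ a b c d → (a * b) - (c * d) ≡ a * (b - d) + (a - c) * d
    mul-lem = solve-∀
    const-lem : ∀ a → a - a ≡ + 0 * a
    const-lem = solve-∀

  constₚ : ℤ → ℤₚ p
  constₚ z = mkℤₚ (λ _ → z)
    (λ n → subst (_ ∣_) (sym (const-lem z)) (∣m⇒∣m*n z (∣n⇒∣m*n (+ 0) {+ 0} (divides0 n))))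
    where
      open import Data.Integer.Divisibility.Signed using (divides)
      divides0 : ∀ n → (+ (p ^ n)) ∣ + 0
      divides0 n = divides (+ 0) refl

  _+ₚ_ : ℤₚ p → ℤₚ p → ℤₚ p
  x +ₚ y = mkℤₚ (λ n → seq x n + seq y n)
    (λ n → subst (_ ∣_) (sym (add-lem (seq x (suc n)) (seq y (suc n)) (seq x n) (seq y n)))
                 (∣m∣n⇒∣m+n (coh x n) (coh y n)))

  _*ₚ_ : ℤₚ p → ℤₚ p → ℤₚ p
  x *ₚ y = mkℤₚ (λ n → seq x n * seq y n)
    (λ n → subst (_ ∣_) (sym (mul-lem (seq x (suc n)) (seq y (suc n)) (seq x n) (seq y n)))
                 (∣m∣n⇒∣m+n (∣n⇒∣m*n (seq x (suc n)) (coh y n)) (∣m⇒∣m*n (seq y n) (coh x n))))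

-- p-adic numbers ℚₚ = ℤₚ[1/p]: the pair (a , m) stands for a / p^m.

record ℚₚ (p : ℕ) : Set where
  constructor _/p^_
  field
    num : ℤₚ p
    den : ℕ
open ℚₚ public

module _ {p : ℕ} where

  _≈q_ : ℚₚ p → ℚₚ p → Set
  x ≈q y = (num x *ₚ constₚ (+ (p ^ den y))) ≈ₚ (num y *ₚ constₚ (+ (p ^ den x)))

  _+q_ : ℚₚ p → ℚₚ p → ℚₚ p
  x +q y = ((num x *ₚ constₚ (+ (p ^ den y))) +ₚ (num y *ₚ constₚ (+ (p ^ den x))))
             /p^ (den x ℕ.+ den y)

  _*q_ : ℚₚ p → ℚₚ p → ℚₚ p
  x *q y = (num x *ₚ num y) /p^ (den x ℕ.+ den y)

  ℤₚ→ℚₚ : ℤₚ p → ℚₚ p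
  ℤₚ→ℚₚ a = a /p^ 0

  0q 1q : ℚₚ p
  0q = constₚ (+ 0) /p^ 0
  1q = constₚ (+ 1) /p^ 0

  Unitq : ℚₚ p → Set
  Unitq x = Σ (ℚₚ p) λ y → (x *q y) ≈q 1q

-- Upper triangular 2×2 matrices  ( a  b )
--                                ( 0  d )  over ℚₚ;
-- B = those with a, d invertible.

record Tri (p : ℕ) : Set where
  constructor tri
  field
    ent-a ent-b ent-d : ℚₚ p
open Tri public

module _ {p : ℕ} where

  _≈T_ : Tri p → Tri p → Set
  g ≈T h = (ent-a g ≈q ent-a h) × (ent-b g ≈q ent-b h) × (ent-d g ≈q ent-d h)

  _·T_ : Tri p → Tri p → Tri p
  g ·T h = tri (ent-a g *q ent-a h)
               ((ent-a g *q ent-b h) +q (ent-b g *q ent-d h))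
               (ent-d g *q ent-d h)

  1T : Tri p
  1T = tri 1q 0q 1q

  InB : Tri p → Set
  InB g = Unitq (ent-a g) × Unitq (ent-d g)

  _^T_ : Tri p → ℕ → Tri p
  g ^T zero = 1T
  g ^T suc j = g ·T (g ^T j)

  unip : ℚₚ p → Tri p
  unip x = tri 1q x 1q

τ : (p k : ℕ) → Tri p
τ p k = unip (constₚ -[1+ 0 ] /p^ k)

module _ {c ℓ : Level} (E : CommutativeRing c ℓ) where
  open CommutativeRing E hiding (_+_; _*_; _-_)
  open CommutativeRing E using () renaming (_+_ to _+E_; _*_ to _*E_)

  natE : ℕ → Carrier
  natE zero = 0#
  natE (suc n) = 1# +E natE n

  record IsFiniteFieldOfChar (p : ℕ) : Set (c ⊔ ℓ) where
    field
      nontrivial : ¬ (1# ≈ 0#)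
      inverses   : ∀ x → ¬ (x ≈ 0#) → Σ Carrier λ y → (x *E y) ≈ 1#
      finite     : Σ ℕ λ n → Σ (Fin n → Carrier) λ f → ∀ x → Σ (Fin n) λ i → f i ≈ x
      char-p     : natE p ≈ 0#

-- E-linear representations of B on an E-vector space V.
-- ρ is given on all upper triangular matrices, but only its values on B
-- are constrained (values outside B are irrelevant).

module _ {c ℓ m ℓm : Level} (p : ℕ) {E : CommutativeRing c ℓ} (V : Module E m ℓm) where
  open Module V

  record IsRepB (ρ : Tri p → Carrierᴹ → Carrierᴹ) : Set (c ⊔ m ⊔ ℓm) where
    field
      ρ-+     : ∀ g → InB g → ∀ x y → ρ g (x +ᴹ y) ≈ᴹ (ρ g x +ᴹ ρ g y)
      ρ-*ₗ    : ∀ g → InB g → ∀ a x → ρ g (a *ₗ x) ≈ᴹ (a *ₗ ρ g x)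
      ρ-cong  : ∀ g h → InB g → InB h → g ≈T h → ∀ x y → x ≈ᴹ y → ρ g x ≈ᴹ ρ h y
      ρ-id    : ∀ x → ρ 1T x ≈ᴹ x
      ρ-hom   : ∀ g h → InB g → InB h → ∀ x → ρ (g ·T h) x ≈ᴹ ρ g (ρ h x)

  sumᴹ : ℕ → (ℕ → Carrierᴹ) → Carrierᴹ
  sumᴹ zero f = 0ᴹ
  sumᴹ (suc n) f = sumᴹ n f +ᴹ f n

  vℓ : (ρ : Tri p → Carrierᴹ → Carrierᴹ) → (k l : ℕ) → Carrierᴹ → Carrierᴹ
  vℓ ρ k l v = sumᴹ (p ^ k) (λ j → natE E (j C l) *ₗ ρ (τ p k ^T j) v)

{-# OPTIONS --safe #-}
-- Let T = ρ(τ_k), u_j = T^j v and N = p^k, so that v_ℓ = Σ_{j<N} (j C ℓ) u_j.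
-- Since τ_k^N = (1 -1; 0 1) fixes v, the orbit is N-periodic, and Pascal's rule gives
--   v_0 + u_N = u_0 + T v_0   and   v_{ℓ+1} + (N C ℓ+1) u_N = T v_ℓ + T v_{ℓ+1}.
-- As p divides N C ℓ for 0 < ℓ < N, v_0 is fixed by T, v_{ℓ+1} is fixed whenever v_ℓ = 0,
-- and v_{N-1} = u_{N-1} ≠ 0; so the least ℓ with v_ℓ ≠ 0 works.
module Submission where

open import Defs
open import Level using (Level)
open import Data.Nat using (ℕ; _^_; _<_)
open import Data.Nat.Primality using (Prime)
open import Data.Product using (Σ; _×_)
open import Relation.Nullary using (¬_)
open import Algebra.Bundles using (CommutativeRing)
open import Algebra.Module.Bundles using (Module)

open import Data.Nat using (zero; suc; NonZero; s≤s; z≤n)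
open import Data.Nat.Properties using (m^n>0; n<1+n; <-trans)
open import Data.Nat.Primality using (prime⇒nonZero)
open import Data.Nat.Combinatorics using (_C_)
open import Data.Product using (_,_)
open import Data.Integer using (-[1+_])

module Binomial where

  open import Data.Nat
  open import Data.Nat.Properties
  open import Data.Nat.Combinatorics
  open import Data.Nat.Divisibility
  open import Data.Nat.DivMod using (m/n*n≡m)
  open import Data.Nat.Primality
  open import Data.Sum using (inj₁; inj₂)
  open import Data.Empty using (⊥-elim)
  open import Relation.Nullary using (yes; no)
  open import Relation.Binary.PropositionalEquality
  open import Data.Nat.Tactic.RingSolver using (solve-∀)

  [k+1]*[n+1]C[k+1]≡[n+1]*nCk : ∀ n k → suc k * (suc n C suc k) ≡ suc n * (n C k)
  [k+1]*[n+1]C[k+1]≡[n+1]*nCk n k with k ≤? n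
  ... | no k≰n = begin
    suc k * (suc n C suc k) ≡⟨ cong (suc k *_) (k>n⇒nCk≡0 (s≤s (≰⇒> k≰n))) ⟩
    suc k * 0               ≡⟨ *-zeroʳ (suc k) ⟩
    0                       ≡⟨ *-zeroʳ (suc n) ⟨
    suc n * 0               ≡⟨ cong (suc n *_) (k>n⇒nCk≡0 (≰⇒> k≰n)) ⟨
    suc n * (n C k)         ∎
    where open ≡-Reasoning
  ... | yes k≤n = *-cancelʳ-≡ _ _ (k ! * (n ∸ k) !) {{k !* (n ∸ k) !≢0}} (begin
    suc k * (suc n C suc k) * (k ! * (n ∸ k) !) ≡⟨ regroup (suc k) (suc n C suc k) (k !) ((n ∸ k) !) ⟩
    (suc n C suc k) * (suc k ! * (n ∸ k) !)     ≡⟨ nCk*k![n∸k]!≡n! (s≤s k≤n) ⟩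
    suc n * n !                                 ≡⟨ cong (suc n *_) (nCk*k![n∸k]!≡n! k≤n) ⟨
    suc n * ((n C k) * (k ! * (n ∸ k) !))       ≡⟨ *-assoc (suc n) (n C k) _ ⟨
    suc n * (n C k) * (k ! * (n ∸ k) !)         ∎)
    where
      open ≡-Reasoning
      regroup : ∀ a b c d → a * b * (c * d) ≡ b * ((a * c) * d)
      regroup = solve-∀
      nCk*k![n∸k]!≡n! : ∀ {n k} → k ≤ n → (n C k) * (k ! * (n ∸ k) !) ≡ n !
      nCk*k![n∸k]!≡n! {n} {k} k≤n = trans (cong (_* (k ! * (n ∸ k) !)) (nCk≡n!/k![n-k]! k≤n))
        (m/n*n≡m {{k !* (n ∸ k) !≢0}} (k![n∸k]!∣n! k≤n))

  n∣k*nCk : ∀ n k → n ∣ k * (n C k)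
  n∣k*nCk n       zero    = n ∣0
  n∣k*nCk zero    (suc k) = subst (0 ∣_) (sym (*-zeroʳ (suc k))) ∣-refl
  n∣k*nCk (suc n) (suc k) = divides (n C k)
    (trans ([k+1]*[n+1]C[k+1]≡[n+1]*nCk n k) (*-comm (suc n) (n C k)))

  p^k∣m*n∧p∤n⇒p^k∣m : ∀ {p n} → Prime p → ¬ p ∣ n → ∀ k m → p ^ k ∣ m * n → p ^ k ∣ m
  p^k∣m*n∧p∤n⇒p^k∣m pp p∤n zero m _ = 1∣ m
  p^k∣m*n∧p∤n⇒p^k∣m {p} {n} pp p∤n (suc k) m p^[k+1]∣mn
    with euclidsLemma m n pp (∣-trans (m∣m*n (p ^ k)) p^[k+1]∣mn)
  ... | inj₂ p∣n = ⊥-elim (p∤n p∣n)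
  ... | inj₁ (divides q refl) = subst (_∣ q * p) (*-comm (p ^ k) p)
      (*-monoˡ-∣ p (p^k∣m*n∧p∤n⇒p^k∣m pp p∤n k q (*-cancelʳ-∣ p {{prime⇒nonZero pp}} p^k*p∣qn*p)))
    where
      swap : ∀ a b c → a * b * c ≡ a * c * b
      swap = solve-∀
      p^k*p∣qn*p : p ^ k * p ∣ q * n * p
      p^k*p∣qn*p = subst₂ _∣_ (*-comm p (p ^ k)) (swap q p n) p^[k+1]∣mn

  -- If p ∤ (p^k C l) then p^k ∣ l, since p^k ∣ l * (p^k C l).
  p∣[p^k]Cl : ∀ {p} → Prime p → ∀ k {l} → 0 < l → l < p ^ k → p ∣ p ^ k C l
  p∣[p^k]Cl {p} pp k {l} 0<l l<p^k with p ∣? p ^ k C l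
  ... | yes p∣C = p∣C
  ... | no  p∤C = ⊥-elim (<⇒≱ l<p^k (∣⇒≤ {{>-nonZero 0<l}}
      (p^k∣m*n∧p∤n⇒p^k∣m pp p∤C k l (n∣k*nCk (p ^ k) l))))

open Binomial

module _ {c ℓ} (E : CommutativeRing c ℓ) where

  open CommutativeRing E
  import Data.Nat as ℕ
  open import Data.Nat.Combinatorics using (nCk+nC[k+1]≡[n+1]C[k+1])
  open import Data.Nat.Divisibility using (_∣_; divides-refl)
  open import Relation.Binary.PropositionalEquality using (cong)
  open import Relation.Binary.Reasoning.Setoid setoid

  natE-+ : ∀ m n → natE E (m ℕ.+ n) ≈ natE E m + natE E n
  natE-+ zero    n = sym (+-identityˡ (natE E n))
  natE-+ (suc m) n = trans (+-congˡ (natE-+ m n)) (sym (+-assoc 1# (natE E m) (natE E n)))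

  natE-pascal : ∀ n k → natE E (suc n C suc k) ≈ natE E (n C k) + natE E (n C suc k)
  natE-pascal n k = begin
    natE E (suc n C suc k)                ≡⟨ cong (natE E) (nCk+nC[k+1]≡[n+1]C[k+1] n k) ⟨
    natE E (n C k ℕ.+ n C suc k)          ≈⟨ natE-+ (n C k) (n C suc k) ⟩
    natE E (n C k) + natE E (n C suc k)   ∎

  natE-∣ : ∀ {p n} → natE E p ≈ 0# → p ∣ n → natE E n ≈ 0#
  natE-∣ {p} char-p (divides-refl q) = natE-*char q
    where
      natE-*char : ∀ q → natE E (q ℕ.* p) ≈ 0#
      natE-*char zero    = refl
      natE-*char (suc q) = begin
        natE E (p ℕ.+ q ℕ.* p)       ≈⟨ natE-+ p (q ℕ.* p) ⟩
        natE E p + natE E (q ℕ.* p)  ≈⟨ +-cong char-p (natE-*char q) ⟩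
        0# + 0#                      ≈⟨ +-identityʳ 0# ⟩
        0#                           ∎

¬¬-least-counterexample : ∀ {a} {P Q : ℕ → Set a} (M : ℕ) → Q 0
  → (∀ l → suc l < suc M → P l → Q (suc l)) → ¬ P M
  → ¬ ¬ (Σ ℕ λ l → l < suc M × ¬ P l × Q l)
¬¬-least-counterexample {P = P} {Q} M Q0 P⇒Q ¬PM none = ¬¬P M (n<1+n M) ¬PM
  where
    ¬¬P : ∀ l → l < suc M → ¬ ¬ P l
    ¬¬P zero    0<N   ¬P0 = none (0 , 0<N , ¬P0 , Q0)
    ¬¬P (suc l) l+1<N ¬Pl+1 =
      ¬¬P l (<-trans (n<1+n l) l+1<N) (λ Pl → none (suc l , l+1<N , ¬Pl+1 , P⇒Q l l+1<N Pl))

module _ {r ℓr m ℓm} (p : ℕ) {E : CommutativeRing r ℓr} (V : Module E m ℓm) where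

  open Module V
  open CommutativeRing E using (Carrier; 0#; 1#; _≈_; +-identityʳ)
  open import Data.Nat.Combinatorics using (nCn≡1; k>n⇒nCk≡0)
  open import Relation.Binary.PropositionalEquality using (cong)
  open import Relation.Binary.Reasoning.Setoid ≈ᴹ-setoid
  open import Algebra.Solver.CommutativeMonoid +ᴹ-commutativeMonoid using (solve; _⊜_; _⊕_)
  open import Algebra.Properties.Group +ᴹ-group using (∙-cancelˡ)

  sumᴹ-vanishes : ∀ n f → (∀ j → j < n → f j ≈ᴹ 0ᴹ) → sumᴹ p V n f ≈ᴹ 0ᴹ
  sumᴹ-vanishes zero    f f≈0 = ≈ᴹ-refl
  sumᴹ-vanishes (suc n) f f≈0 = begin
    sumᴹ p V n f +ᴹ f n ≈⟨ +ᴹ-cong (sumᴹ-vanishes n f (λ j j<n → f≈0 j (<-trans j<n (n<1+n n)))) (f≈0 n (n<1+n n)) ⟩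
    0ᴹ +ᴹ 0ᴹ            ≈⟨ +ᴹ-identityʳ 0ᴹ ⟩
    0ᴹ                  ∎

  natE-1-*ₗ : ∀ x → natE E 1 *ₗ x ≈ᴹ x
  natE-1-*ₗ x = ≈ᴹ-trans (*ₗ-cong (+-identityʳ 1#) ≈ᴹ-refl) (*ₗ-identityˡ x)

  +ᴹ-interchange : ∀ a b c d → (a +ᴹ b) +ᴹ (c +ᴹ d) ≈ᴹ (a +ᴹ c) +ᴹ (b +ᴹ d)
  +ᴹ-interchange = solve 4 (λ a b c d → ((a ⊕ b) ⊕ (c ⊕ d)) ⊜ ((a ⊕ c) ⊕ (b ⊕ d))) ≈ᴹ-refl

  module BinomialSums (T : Carrierᴹ → Carrierᴹ)
    (T-cong : ∀ {x y} → x ≈ᴹ y → T x ≈ᴹ T y)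
    (T-+ : ∀ x y → T (x +ᴹ y) ≈ᴹ T x +ᴹ T y)
    (T-*ₗ : ∀ a x → T (a *ₗ x) ≈ᴹ a *ₗ T x)
    (u : ℕ → Carrierᴹ) (u-orbit : ∀ j → T (u j) ≈ᴹ u (suc j)) where

    T-0ᴹ : T 0ᴹ ≈ᴹ 0ᴹ
    T-0ᴹ = begin
      T 0ᴹ         ≈⟨ T-cong (*ₗ-zeroˡ 0ᴹ) ⟨
      T (0# *ₗ 0ᴹ) ≈⟨ T-*ₗ 0# 0ᴹ ⟩
      0# *ₗ T 0ᴹ   ≈⟨ *ₗ-zeroˡ (T 0ᴹ) ⟩
      0ᴹ           ∎

    binomialSum : ℕ → ℕ → Carrierᴹ
    binomialSum N l = sumᴹ p V N (λ j → natE E (j C l) *ₗ u j)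

    T-binomialSum-suc : ∀ N l →
      T (binomialSum (suc N) l) ≈ᴹ T (binomialSum N l) +ᴹ natE E (N C l) *ₗ u (suc N)
    T-binomialSum-suc N l = begin
      T (binomialSum N l +ᴹ natE E (N C l) *ₗ u N)   ≈⟨ T-+ _ _ ⟩
      T (binomialSum N l) +ᴹ T (natE E (N C l) *ₗ u N) ≈⟨ +ᴹ-congˡ (T-*ₗ _ (u N)) ⟩
      T (binomialSum N l) +ᴹ natE E (N C l) *ₗ T (u N) ≈⟨ +ᴹ-congˡ (*ₗ-congˡ (u-orbit N)) ⟩
      T (binomialSum N l) +ᴹ natE E (N C l) *ₗ u (suc N) ∎

    binomialSum₀-shift : ∀ N → binomialSum N 0 +ᴹ u N ≈ᴹ u 0 +ᴹ T (binomialSum N 0)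
    binomialSum₀-shift zero = begin
      0ᴹ +ᴹ u 0   ≈⟨ +ᴹ-comm 0ᴹ (u 0) ⟩
      u 0 +ᴹ 0ᴹ   ≈⟨ +ᴹ-congˡ T-0ᴹ ⟨
      u 0 +ᴹ T 0ᴹ ∎
    binomialSum₀-shift (suc N) = begin
      (binomialSum N 0 +ᴹ natE E 1 *ₗ u N) +ᴹ u (suc N) ≈⟨ +ᴹ-congʳ (+ᴹ-congˡ (natE-1-*ₗ (u N))) ⟩
      (binomialSum N 0 +ᴹ u N) +ᴹ u (suc N)             ≈⟨ +ᴹ-congʳ (binomialSum₀-shift N) ⟩
      (u 0 +ᴹ T (binomialSum N 0)) +ᴹ u (suc N)         ≈⟨ +ᴹ-assoc (u 0) _ _ ⟩
      u 0 +ᴹ (T (binomialSum N 0) +ᴹ u (suc N))         ≈⟨ +ᴹ-congˡ (+ᴹ-congˡ (natE-1-*ₗ (u (suc N)))) ⟨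
      u 0 +ᴹ (T (binomialSum N 0) +ᴹ natE E 1 *ₗ u (suc N)) ≈⟨ +ᴹ-congˡ (T-binomialSum-suc N 0) ⟨
      u 0 +ᴹ T (binomialSum (suc N) 0)                  ∎

    binomialSum-shift : ∀ N l → binomialSum N (suc l) +ᴹ natE E (N C suc l) *ₗ u N
                                ≈ᴹ T (binomialSum N l) +ᴹ T (binomialSum N (suc l))
    binomialSum-shift zero l = begin
      0ᴹ +ᴹ 0# *ₗ u 0 ≈⟨ +ᴹ-congˡ (*ₗ-zeroˡ (u 0)) ⟩
      0ᴹ +ᴹ 0ᴹ        ≈⟨ +ᴹ-cong T-0ᴹ T-0ᴹ ⟨
      T 0ᴹ +ᴹ T 0ᴹ    ∎
    binomialSum-shift (suc N) l = begin
      (binomialSum N (suc l) +ᴹ binomE N (suc l) *ₗ u N) +ᴹ binomE (suc N) (suc l) *ₗ u (suc N)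
        ≈⟨ +ᴹ-cong (binomialSum-shift N l) pascal ⟩
      (T (binomialSum N l) +ᴹ T (binomialSum N (suc l))) +ᴹ (binomE N l *ₗ u (suc N) +ᴹ binomE N (suc l) *ₗ u (suc N))
        ≈⟨ +ᴹ-interchange _ _ _ _ ⟩
      (T (binomialSum N l) +ᴹ binomE N l *ₗ u (suc N)) +ᴹ (T (binomialSum N (suc l)) +ᴹ binomE N (suc l) *ₗ u (suc N))
        ≈⟨ +ᴹ-cong (T-binomialSum-suc N l) (T-binomialSum-suc N (suc l)) ⟨
      T (binomialSum (suc N) l) +ᴹ T (binomialSum (suc N) (suc l)) ∎
      where
        binomE : ℕ → ℕ → Carrier
        binomE j k = natE E (j C k)
        pascal : binomE (suc N) (suc l) *ₗ u (suc N) ≈ᴹ binomE N l *ₗ u (suc N) +ᴹ binomE N (suc l) *ₗ u (suc N)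
        pascal = ≈ᴹ-trans (*ₗ-congʳ (natE-pascal E N l)) (*ₗ-distribʳ (u (suc N)) (binomE N l) (binomE N (suc l)))

    binomialSum₀-fixed : ∀ N → u N ≈ᴹ u 0 → T (binomialSum N 0) ≈ᴹ binomialSum N 0
    binomialSum₀-fixed N periodic = ≈ᴹ-sym (∙-cancelˡ (u 0) _ _ (begin
      u 0 +ᴹ binomialSum N 0   ≈⟨ +ᴹ-comm (u 0) _ ⟩
      binomialSum N 0 +ᴹ u 0   ≈⟨ +ᴹ-congˡ periodic ⟨
      binomialSum N 0 +ᴹ u N   ≈⟨ binomialSum₀-shift N ⟩
      u 0 +ᴹ T (binomialSum N 0) ∎))

    binomialSum-suc-fixed : ∀ N l → natE E (N C suc l) ≈ 0# → binomialSum N l ≈ᴹ 0ᴹ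
      → T (binomialSum N (suc l)) ≈ᴹ binomialSum N (suc l)
    binomialSum-suc-fixed N l NCl+1≈0 wl≈0 = begin
      T (binomialSum N (suc l))                    ≈⟨ +ᴹ-identityˡ _ ⟨
      0ᴹ +ᴹ T (binomialSum N (suc l))              ≈⟨ +ᴹ-congʳ (≈ᴹ-trans (T-cong wl≈0) T-0ᴹ) ⟨
      T (binomialSum N l) +ᴹ T (binomialSum N (suc l)) ≈⟨ binomialSum-shift N l ⟨
      binomialSum N (suc l) +ᴹ natE E (N C suc l) *ₗ u N ≈⟨ +ᴹ-congˡ (≈ᴹ-trans (*ₗ-congʳ NCl+1≈0) (*ₗ-zeroˡ (u N))) ⟩
      binomialSum N (suc l) +ᴹ 0ᴹ                  ≈⟨ +ᴹ-identityʳ _ ⟩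
      binomialSum N (suc l)                        ∎

    binomialSum-last : ∀ M → binomialSum (suc M) M ≈ᴹ u M
    binomialSum-last M = begin
      binomialSum M M +ᴹ natE E (M C M) *ₗ u M ≈⟨ +ᴹ-cong (sumᴹ-vanishes M _ below-vanish) (≈ᴹ-reflexive (cong (λ n → natE E n *ₗ u M) (nCn≡1 M))) ⟩
      0ᴹ +ᴹ natE E 1 *ₗ u M                    ≈⟨ +ᴹ-identityˡ _ ⟩
      natE E 1 *ₗ u M                          ≈⟨ natE-1-*ₗ (u M) ⟩
      u M                                      ∎
      where
        below-vanish : ∀ j → j < M → natE E (j C M) *ₗ u j ≈ᴹ 0ᴹ
        below-vanish j j<M = ≈ᴹ-trans (≈ᴹ-reflexive (cong (λ n → natE E n *ₗ u j) (k>n⇒nCk≡0 j<M))) (*ₗ-zeroˡ (u j))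

    fixed-binomialSum : ∀ N → 0 < N → u N ≈ᴹ u 0 → ¬ u 0 ≈ᴹ 0ᴹ
      → (∀ l → 0 < l → l < N → natE E (N C l) ≈ 0#)
      → ¬ ¬ (Σ ℕ λ l → l < N × ¬ binomialSum N l ≈ᴹ 0ᴹ × T (binomialSum N l) ≈ᴹ binomialSum N l)
    fixed-binomialSum (suc M) _ periodic u0≉0 NCl≈0 =
      ¬¬-least-counterexample M (binomialSum₀-fixed (suc M) periodic)
        (λ l l+1<N → binomialSum-suc-fixed (suc M) l (NCl≈0 (suc l) (s≤s z≤n) l+1<N))
        last≉0
      where
        last≉0 : ¬ binomialSum (suc M) M ≈ᴹ 0ᴹ
        last≉0 wM≈0 = u0≉0 (begin
          u 0          ≈⟨ periodic ⟨
          u (suc M)    ≈⟨ u-orbit M ⟨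
          T (u M)      ≈⟨ T-cong (≈ᴹ-trans (≈ᴹ-sym (binomialSum-last M)) wM≈0) ⟩
          T 0ᴹ         ≈⟨ T-0ᴹ ⟩
          0ᴹ           ∎)

module UnipotentPowers {p : ℕ} where

  import Data.Nat as ℕ
  import Data.Nat.Properties as ℕ
  open import Data.Integer using (ℤ; +_; +0; _+_; _*_; _-_)
  import Data.Integer.Properties as ℤ
  open import Data.Integer.Divisibility.Signed using (_∣_; divides)
  open import Data.Integer.Tactic.RingSolver using (solve-∀)
  open import Data.Product using (proj₁; proj₂)
  open import Relation.Binary.PropositionalEquality
  open ≡-Reasoning

  P : ℕ → ℤ
  P e = + (p ^ e)

  P-+ : ∀ a b → P (a ℕ.+ b) ≡ P a * P b
  P-+ a b = trans (cong +_ (ℕ.^-distribˡ-+-* p a b)) (ℤ.pos-* (p ^ a) (p ^ b))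

  ≡⇒∣- : ∀ {d} x y → x ≡ y → d ∣ x - y
  ≡⇒∣- {d} x _ refl = divides +0 (trans (ℤ.+-inverseʳ x) (sym (ℤ.*-zeroˡ d)))

  ≈q-refl : (x : ℚₚ p) → x ≈q x
  ≈q-refl x n = ≡⇒∣- (seq (num x *ₚ constₚ (P (den x))) n) _ refl

  ≈T-refl : (g : Tri p) → g ≈T g
  ≈T-refl g = ≈q-refl (ent-a g) , ≈q-refl (ent-b g) , ≈q-refl (ent-d g)

  -- Equal to 1q on the nose, not merely up to ≈q.
  record IsOne (x : ℚₚ p) : Set where
    field
      num≡1 : ∀ n → seq (num x) n ≡ + 1
      den≡0 : den x ≡ 0
  open IsOne

  IsOne-1q : IsOne 1q
  IsOne-1q = record { num≡1 = λ n → refl ; den≡0 = refl }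

  IsOne-*q : ∀ {x y} → IsOne x → IsOne y → IsOne (x *q y)
  IsOne-*q x≡1 y≡1 = record
    { num≡1 = λ n → cong₂ _*_ (num≡1 x≡1 n) (num≡1 y≡1 n)
    ; den≡0 = cong₂ ℕ._+_ (den≡0 x≡1) (den≡0 y≡1)
    }

  IsOne⇒≈q1q : ∀ {x} → IsOne x → x ≈q 1q
  IsOne⇒≈q1q x≡1 n rewrite num≡1 x≡1 n | den≡0 x≡1 = ≡⇒∣- (+ 1) (+ 1) refl

  IsOne⇒Unitq : ∀ {x} → IsOne x → Unitq x
  IsOne⇒Unitq x≡1 = 1q , IsOne⇒≈q1q (IsOne-*q x≡1 IsOne-1q)

  InB-unip : ∀ x → InB (unip x)
  InB-unip x = IsOne⇒Unitq IsOne-1q , IsOne⇒Unitq IsOne-1q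

  unip^T-diagonal : ∀ x j → IsOne (ent-a (unip x ^T j)) × IsOne (ent-d (unip x ^T j))
  unip^T-diagonal x zero    = IsOne-1q , IsOne-1q
  unip^T-diagonal x (suc j) = IsOne-*q {1q} {ent-a (unip x ^T j)} IsOne-1q (proj₁ (unip^T-diagonal x j))
                            , IsOne-*q {1q} {ent-d (unip x ^T j)} IsOne-1q (proj₂ (unip^T-diagonal x j))

  InB-unip^T : ∀ x j → InB (unip x ^T j)
  InB-unip^T x j = IsOne⇒Unitq (proj₁ (unip^T-diagonal x j)) , IsOne⇒Unitq (proj₂ (unip^T-diagonal x j))

  unip^T-numerator : ∀ z k j n → let b = ent-b (unip (constₚ z /p^ k) ^T j) in
    seq (num b) n * P k ≡ (+ j * z) * P (den b)
  unip^T-numerator z k zero    n = refl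
  unip^T-numerator z k (suc j) n = begin
    ((+ 1 * Bn) * P (k ℕ.+ dD) + (z * Dn) * P db) * P k
      ≡⟨ cong₂ (λ e t → ((+ 1 * Bn) * P (k ℕ.+ e) + (z * t) * P db) * P k) dD≡0 (num≡1 D≡1 n) ⟩
    ((+ 1 * Bn) * P (k ℕ.+ 0) + (z * + 1) * P db) * P k
      ≡⟨ cong (λ e → ((+ 1 * Bn) * P e + (z * + 1) * P db) * P k) (ℕ.+-identityʳ k) ⟩
    ((+ 1 * Bn) * P k + (z * + 1) * P db) * P k
      ≡⟨ expand Bn (P k) z (P db) ⟩
    (Bn * P k) * P k + z * P db * P k
      ≡⟨ cong (λ t → t * P k + z * P db * P k) (unip^T-numerator z k j n) ⟩
    (+ j * z) * P db * P k + z * P db * P k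
      ≡⟨ collect (+ j) z (P db) (P k) ⟩
    (+ suc j * z) * (P db * P k)
      ≡⟨ cong (+ suc j * z *_) (P-+ db k) ⟨
    (+ suc j * z) * P (db ℕ.+ k)
      ≡⟨ cong (λ e → (+ suc j * z) * P (db ℕ.+ e)) (trans (cong (k ℕ.+_) dD≡0) (ℕ.+-identityʳ k)) ⟨
    (+ suc j * z) * P (db ℕ.+ (k ℕ.+ dD)) ∎
    where
      g : Tri p
      g = unip (constₚ z /p^ k) ^T j
      D≡1 : IsOne (ent-d g)
      D≡1 = proj₂ (unip^T-diagonal (constₚ z /p^ k) j)
      Bn Dn : ℤ
      Bn = seq (num (ent-b g)) n
      Dn = seq (num (ent-d g)) n
      db dD : ℕ
      db = den (ent-b g)
      dD = den (ent-d g)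
      dD≡0 : dD ≡ 0
      dD≡0 = den≡0 D≡1
      expand : ∀ b r z q → ((+ 1 * b) * r + (z * + 1) * q) * r ≡ (b * r) * r + z * q * r
      expand = solve-∀
      collect : ∀ j z q r → (j * z) * q * r + z * q * r ≡ ((+ 1 + j) * z) * (q * r)
      collect = solve-∀

  unip^T-period : ∀ .{{_ : ℕ.NonZero p}} z k → (unip (constₚ z /p^ k) ^T (p ^ k)) ≈T unip (constₚ z /p^ 0)
  unip^T-period z k = IsOne⇒≈q1q (proj₁ diagonal) , b≈z , IsOne⇒≈q1q (proj₂ diagonal)
    where
      diagonal : IsOne (ent-a (unip (constₚ z /p^ k) ^T (p ^ k))) × IsOne (ent-d (unip (constₚ z /p^ k) ^T (p ^ k)))
      diagonal = unip^T-diagonal (constₚ z /p^ k) (p ^ k)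
      b : ℚₚ p
      b = ent-b (unip (constₚ z /p^ k) ^T (p ^ k))
      num≡ : ∀ n → seq (num b) n ≡ z * P (den b)
      num≡ n = ℤ.*-cancelʳ-≡ (seq (num b) n) (z * P (den b)) (P k) {{ℕ.m^n≢0 p k}} (begin
        seq (num b) n * P k     ≡⟨ unip^T-numerator z k (p ^ k) n ⟩
        (P k * z) * P (den b)   ≡⟨ rearrange (P k) z (P (den b)) ⟩
        (z * P (den b)) * P k   ∎)
        where
          rearrange : ∀ a z q → (a * z) * q ≡ (z * q) * a
          rearrange = solve-∀
      b≈z : b ≈q (constₚ z /p^ 0)
      b≈z n = ≡⇒∣- (seq (num b) n * + 1) (z * P (den b)) (trans (ℤ.*-identityʳ (seq (num b) n)) (num≡ n))

open UnipotentPowers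

lemma1p2p4 : {c ℓ m ℓm : Level} (p : ℕ) → Prime p
    → (E : CommutativeRing c ℓ) → IsFiniteFieldOfChar E p
    → (V : Module E m ℓm)
    → (ρ : Tri p → Module.Carrierᴹ V → Module.Carrierᴹ V) → IsRepB p V ρ
    → (v : Module.Carrierᴹ V) → ¬ (Module._≈ᴹ_ V v (Module.0ᴹ V))
    → (∀ (z : ℤₚ p) → Module._≈ᴹ_ V (ρ (unip (ℤₚ→ℚₚ z)) v) v)
    → (k : ℕ)
    → ¬ ¬ (Σ ℕ λ l → (l < p ^ k)
             × ¬ (Module._≈ᴹ_ V (vℓ p V ρ k l v) (Module.0ᴹ V))
             × Module._≈ᴹ_ V (ρ (τ p k) (vℓ p V ρ k l v)) (vℓ p V ρ k l v))
lemma1p2p4 p p-prime E E-field V ρ ρ-rep v v≉0 v-fixed k =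
  fixed-binomialSum (p ^ k) (m^n>0 p k) periodic
    (λ u0≈0 → v≉0 (≈ᴹ-trans (≈ᴹ-sym (ρ-id v)) u0≈0)) p^kCl≈0
  where
    open Module V
    open IsRepB ρ-rep
    instance
      p≢0 : NonZero p
      p≢0 = prime⇒nonZero p-prime
    -1/p^k -1q : ℚₚ p
    -1/p^k = constₚ -[1+ 0 ] /p^ k
    -1q    = constₚ -[1+ 0 ] /p^ 0
    τ∈B : InB (τ p k)
    τ∈B = InB-unip -1/p^k
    u : ℕ → Carrierᴹ
    u j = ρ (τ p k ^T j) v
    T-cong : ∀ {x y} → x ≈ᴹ y → ρ (τ p k) x ≈ᴹ ρ (τ p k) y
    T-cong {x} {y} = ρ-cong (τ p k) (τ p k) τ∈B τ∈B (≈T-refl (τ p k)) x y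
    u-orbit : ∀ j → ρ (τ p k) (u j) ≈ᴹ u (suc j)
    u-orbit j = ≈ᴹ-sym (ρ-hom (τ p k) (τ p k ^T j) τ∈B (InB-unip^T -1/p^k j) v)
    open BinomialSums p V (ρ (τ p k)) T-cong (ρ-+ _ τ∈B) (ρ-*ₗ _ τ∈B) u u-orbit
    periodic : u (p ^ k) ≈ᴹ u 0
    periodic = ≈ᴹ-trans
      (ρ-cong (τ p k ^T (p ^ k)) (unip -1q) (InB-unip^T -1/p^k (p ^ k)) (InB-unip -1q)
              (unip^T-period -[1+ 0 ] k) v v ≈ᴹ-refl)
      (≈ᴹ-trans (v-fixed (constₚ -[1+ 0 ])) (≈ᴹ-sym (ρ-id v)))
    p^kCl≈0 : ∀ l → 0 < l → l < p ^ k → CommutativeRing._≈_ E (natE E (p ^ k C l)) (CommutativeRing.0# E)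
    p^kCl≈0 l 0<l l<p^k = natE-∣ E (IsFiniteFieldOfChar.char-p E-field) (p∣[p^k]Cl p-prime k 0<l l<p^k)
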